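{- If $a$ is an integer with $a\ge2$, then \[\overline{p}(a\mid \text{no } 1\text{'s})\,\overline{p}(2) > \overline{p}(a+2\mid \text{no } 1\text{'s}).\]
   Context: An overpartition of $n$ is a partition of $n$ in which the last occurrence of each distinct part may be overlined; $\overline{p}(n)$ is the number of overpartitions of $n$. $\overline{p}(n\mid \text{no } 1\text{'s})$ denotes the number of overpartitions of $n$ having no non-overlined part equal to $1$ (an overlined part $\overline{1}$ is allowed). -}

module Defs where

open import Data.Nat using (ℕ; zero; suc; _+_; _*_; _∸_; _≤?_)
open import Data.Bool using (Bool; true; false)
open import Data.List using (List; []; _∷_; _++_; concatMap; map; length; upTo; filter)
open import Data.Product using (_×_; _,_)
open import Relation.Nullary using (yes; no)

-- An overpartition is encoded by its blocks, listed with strictly decreasing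
-- distinct parts: a block (k , m , b) means the part k (k ≥ 1) occurs m ≥ 1 times,
-- and b = true iff the last occurrence of k is overlined.
Block : Set
Block = ℕ × ℕ × Bool

-- ovp k n : the list of all overpartitions of n whose parts are all ≤ k,
-- each listed exactly once (blocks in strictly decreasing order of part).
ovp : ℕ → ℕ → List (List Block)
ovp zero zero = [] ∷ []
ovp zero (suc n) = []
ovp (suc k) n = ovp k n ++ concatMap choose (upTo (suc n))
  where
  choose : ℕ → List (List Block)
  choose zero = []
  choose (suc m) with (suc k) * (suc m) ≤? n
  ... | no _ = []
  ... | yes _ =
    map ((suc k , suc m , false) ∷_) (ovp k (n ∸ (suc k) * (suc m))) ++
    map ((suc k , suc m , true) ∷_) (ovp k (n ∸ (suc k) * (suc m)))

overpartitions : ℕ → List (List Block)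
overpartitions n = ovp n n

pbar : ℕ → ℕ
pbar n = length (overpartitions n)

-- An overpartition has no non-overlined part equal to 1 iff the part 1 either
-- does not occur, or occurs exactly once and that (last) occurrence is overlined.
noPlain1 : List Block → Bool
noPlain1 [] = true
noPlain1 ((1 , 1 , true) ∷ bs) = noPlain1 bs
noPlain1 ((1 , _ , _) ∷ bs) = false
noPlain1 (_ ∷ bs) = noPlain1 bs

pbarNo1 : ℕ → ℕ
pbarNo1 n = length (filter (λ bs → Data.Bool._≟_ (noPlain1 bs) true) (overpartitions n))

-- Write q k n (pbarNo1≤ k n) for the number of overpartitions of n into parts ≤ k with
-- no non-overlined 1, so that p̄(n | no 1's) = q n n.  Splitting off the occurrences of a part k ≥ 2 (each
-- multiplicity in two ways, by the overline) gives, for n ≥ k,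
--   q k n = q (k-1) n + q (k-1) (n-k) + q k (n-k),
-- and q k n = q (k-1) n for n < k.  By induction on k ≥ 2 this recurrence preserves the
-- bounds q k (n+1) ≤ 2 q k n, and q k (n+1) ≤ 2 q k n - 2 for n ≥ 3; at n = k the new part
-- contributes exactly 2, so the slack there has to be carried separately.  For k = a + 2 this
-- gives q k (a+2) ≤ 4 q k a - 2 = 4 p̄(a | no 1's) - 2, and p̄(2) = 4.
module Submission where

open import Data.Bool using (true; false)
import Data.Bool as Bool
open import Data.List using (List; []; _∷_; _++_; map; concatMap; applyUpTo; filter; length)
open import Data.List.Properties using (length-++; filter-++; map-applyUpTo; concatMap-cong)
open import Data.Nat
open import Data.Nat.Induction using (<-rec)
open import Data.Nat.ListAction using (sum)
open import Data.Nat.Properties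
open import Algebra.Properties.CommutativeSemigroup +-commutativeSemigroup using (interchange)
open import Data.Product using (_,_)
open import Function using (_∘_)
open import Relation.Binary.Definitions using (tri<; tri≈; tri>)
open import Relation.Binary.PropositionalEquality
open import Relation.Nullary using (Dec; yes; no; ¬_; contradiction)

open import Defs

applyUpTo-cong : ∀ {A : Set} {f g : ℕ → A} → (∀ i → f i ≡ g i) →
                 ∀ n → applyUpTo f n ≡ applyUpTo g n
applyUpTo-cong f≗g zero    = refl
applyUpTo-cong f≗g (suc n) = cong₂ _∷_ (f≗g 0) (applyUpTo-cong (f≗g ∘ suc) n)

sum-applyUpTo-truncate : ∀ (f : ℕ → ℕ) {r s} → r ≤ s → (∀ i → r ≤ i → f i ≡ 0) →
                         sum (applyUpTo f s) ≡ sum (applyUpTo f r)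
sum-applyUpTo-truncate f {zero} {zero} _ _ = refl
sum-applyUpTo-truncate f {zero} {suc s} _ f≡0 =
  cong₂ _+_ (f≡0 0 z≤n)
            (sum-applyUpTo-truncate (f ∘ suc) (z≤n {s}) (λ i _ → f≡0 (suc i) z≤n))
sum-applyUpTo-truncate f {suc r} {suc s} (s≤s r≤s) f≡0 =
  cong (f 0 +_) (sum-applyUpTo-truncate (f ∘ suc) r≤s (λ i r≤i → f≡0 (suc i) (s≤s r≤i)))

#noPlain1 : List (List Block) → ℕ
#noPlain1 = length ∘ filter (λ bs → noPlain1 bs Bool.≟ true)

pbarNo1≤ : ℕ → ℕ → ℕ
pbarNo1≤ k n = #noPlain1 (ovp k n)

#noPlain1-++ : ∀ xs ys → #noPlain1 (xs ++ ys) ≡ #noPlain1 xs + #noPlain1 ys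
#noPlain1-++ xs ys = trans (cong length (filter-++ _ xs ys)) (length-++ (filter _ xs))

#noPlain1-concatMap : ∀ {A : Set} (h : A → List (List Block)) xs →
                      #noPlain1 (concatMap h xs) ≡ sum (map (#noPlain1 ∘ h) xs)
#noPlain1-concatMap h []       = refl
#noPlain1-concatMap h (x ∷ xs) =
  trans (#noPlain1-++ (h x) _) (cong (#noPlain1 (h x) +_) (#noPlain1-concatMap h xs))

#noPlain1-map-large : ∀ k m o L → #noPlain1 (map ((suc (suc k) , m , o) ∷_) L) ≡ #noPlain1 L
#noPlain1-map-large k m o []       = refl
#noPlain1-map-large k m o (bs ∷ L) with noPlain1 bs
... | true  = cong suc (#noPlain1-map-large k m o L)
... | false = #noPlain1-map-large k m o L

#noPlain1-map-plain1 : ∀ m o L → #noPlain1 (map ((1 , suc (suc m) , o) ∷_) L) ≡ 0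
#noPlain1-map-plain1 m o []      = refl
#noPlain1-map-plain1 m o (_ ∷ L) = #noPlain1-map-plain1 m o L

layer : ℕ → ℕ → ℕ → List (List Block)
layer k n zero = []
layer k n (suc m) with suc k * suc m ≤? n
... | no _  = []
... | yes _ = map ((suc k , suc m , false) ∷_) (ovp k (n ∸ suc k * suc m))
           ++ map ((suc k , suc m , true) ∷_) (ovp k (n ∸ suc k * suc m))

-- The `_` is the local function `choose` of `ovp`, which is not in scope;
-- it is solved by unification in `ovp-suc`.
choose≗layer : ∀ k n → _ ≗ layer k n

ovp-suc : ∀ k n → ovp (suc k) n ≡ ovp k n ++ concatMap (layer k n) (applyUpTo suc n)
ovp-suc k n = cong (ovp k n ++_) (concatMap-cong (choose≗layer k n) (applyUpTo suc n))

choose≗layer k n zero = refl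
choose≗layer k n (suc m) with suc k * suc m ≤? n
... | no _  = refl
... | yes _ = refl

-- Indexing: #layer k n m counts the layer in which the part suc k occurs suc m times.
#layer : ℕ → ℕ → ℕ → ℕ
#layer k n m = #noPlain1 (layer k n (suc m))

pbarNo1≤-suc : ∀ k n → pbarNo1≤ (suc k) n ≡ pbarNo1≤ k n + sum (applyUpTo (#layer k n) n)
pbarNo1≤-suc k n = begin
  #noPlain1 (ovp (suc k) n)
    ≡⟨ cong #noPlain1 (ovp-suc k n) ⟩
  #noPlain1 (ovp k n ++ concatMap (layer k n) (applyUpTo suc n))
    ≡⟨ #noPlain1-++ (ovp k n) _ ⟩
  pbarNo1≤ k n + #noPlain1 (concatMap (layer k n) (applyUpTo suc n))
    ≡⟨ cong (pbarNo1≤ k n +_) (#noPlain1-concatMap (layer k n) (applyUpTo suc n)) ⟩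
  pbarNo1≤ k n + sum (map (#noPlain1 ∘ layer k n) (applyUpTo suc n))
    ≡⟨ cong (λ xs → pbarNo1≤ k n + sum xs) (map-applyUpTo suc (#noPlain1 ∘ layer k n) n) ⟩
  pbarNo1≤ k n + sum (applyUpTo (#layer k n) n) ∎
  where open ≡-Reasoning

#layer-overflow : ∀ k n m → ¬ (suc k * suc m ≤ n) → #layer k n m ≡ 0
#layer-overflow k n m ¬fits with suc k * suc m ≤? n
... | no _     = refl
... | yes fits = contradiction fits ¬fits

#layer-fits : ∀ k n m → suc (suc k) * suc m ≤ n →
              let r = n ∸ suc (suc k) * suc m in
              #layer (suc k) n m ≡ pbarNo1≤ (suc k) r + pbarNo1≤ (suc k) r
#layer-fits k n m fits with suc (suc k) * suc m ≤? n
... | no ¬fits = contradiction fits ¬fits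
... | yes _    = trans (#noPlain1-++ (map (block false ∷_) L) (map (block true ∷_) L))
                       (cong₂ _+_ (#noPlain1-map-large k (suc m) false L)
                                  (#noPlain1-map-large k (suc m) true L))
  where
  L = ovp (suc k) (n ∸ suc (suc k) * suc m)
  block : Bool.Bool → Block
  block o = (suc (suc k) , suc m , o)

pbarNo1≤-below : ∀ k n → n < suc k → pbarNo1≤ (suc k) n ≡ pbarNo1≤ k n
pbarNo1≤-below k n n<k+1 = begin
  pbarNo1≤ (suc k) n
    ≡⟨ pbarNo1≤-suc k n ⟩
  pbarNo1≤ k n + sum (applyUpTo (#layer k n) n)
    ≡⟨ cong (pbarNo1≤ k n +_) (sum-applyUpTo-truncate (#layer k n) (z≤n {n}) empty) ⟩
  pbarNo1≤ k n + 0
    ≡⟨ +-identityʳ _ ⟩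
  pbarNo1≤ k n ∎
  where
  open ≡-Reasoning
  empty : ∀ i → 0 ≤ i → #layer k n i ≡ 0
  empty i _ = #layer-overflow k n i (<⇒≱ (<-≤-trans n<k+1 (m≤m*n (suc k) (suc i))))

#layer-shift : ∀ k r m → #layer (suc k) (suc (suc k) + r) (suc m) ≡ #layer (suc k) r m
#layer-shift k r m = shift (P * suc m ≤? r)
  where
  open ≡-Reasoning
  P = suc (suc k)
  g = pbarNo1≤ (suc k)
  P*[2+m] : P * suc (suc m) ≡ P + P * suc m
  P*[2+m] = *-suc P (suc m)
  shift : Dec (P * suc m ≤ r) → #layer (suc k) (P + r) (suc m) ≡ #layer (suc k) r m
  shift (yes fits) = begin
    #layer (suc k) (P + r) (suc m)
      ≡⟨ #layer-fits k (P + r) (suc m) (subst (_≤ P + r) (sym P*[2+m]) (+-monoʳ-≤ P fits)) ⟩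
    g (P + r ∸ P * suc (suc m)) + g (P + r ∸ P * suc (suc m))
      ≡⟨ cong (λ x → g x + g x) (trans (cong (P + r ∸_) P*[2+m])
                                        ([m+n]∸[m+o]≡n∸o P r (P * suc m))) ⟩
    g (r ∸ P * suc m) + g (r ∸ P * suc m)
      ≡⟨ sym (#layer-fits k r m fits) ⟩
    #layer (suc k) r m ∎
  shift (no ¬fits) = trans (#layer-overflow (suc k) (P + r) (suc m) ¬fits′)
                           (sym (#layer-overflow (suc k) r m ¬fits))
    where
    ¬fits′ : ¬ (P * suc (suc m) ≤ P + r)
    ¬fits′ fits = ¬fits (+-cancelˡ-≤ P _ _ (subst (_≤ P + r) P*[2+m] fits))

pbarNo1≤-above : ∀ k r → pbarNo1≤ (suc (suc k)) (suc (suc k) + r) ≡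
                 pbarNo1≤ (suc k) (suc (suc k) + r) + pbarNo1≤ (suc k) r + pbarNo1≤ (suc (suc k)) r
pbarNo1≤-above k r = begin
  pbarNo1≤ P (P + r)
    ≡⟨ pbarNo1≤-suc (suc k) (P + r) ⟩
  g (P + r) + (#layer (suc k) (P + r) 0 + sum (applyUpTo (#layer (suc k) (P + r) ∘ suc) (suc k + r)))
    ≡⟨ cong₂ (λ x y → g (P + r) + (x + y)) first
             (cong sum (applyUpTo-cong (#layer-shift k r) (suc k + r))) ⟩
  g (P + r) + ((g r + g r) + sum (applyUpTo (#layer (suc k) r) (suc k + r)))
    ≡⟨ cong (λ x → g (P + r) + ((g r + g r) + x))
            (sum-applyUpTo-truncate (#layer (suc k) r) (m≤n+m r (suc k)) beyond) ⟩
  g (P + r) + ((g r + g r) + sum (applyUpTo (#layer (suc k) r) r))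
    ≡⟨ cong (g (P + r) +_) (+-assoc (g r) (g r) _) ⟩
  g (P + r) + (g r + (g r + sum (applyUpTo (#layer (suc k) r) r)))
    ≡⟨ sym (+-assoc (g (P + r)) (g r) _) ⟩
  g (P + r) + g r + (g r + sum (applyUpTo (#layer (suc k) r) r))
    ≡⟨ cong (g (P + r) + g r +_) (sym (pbarNo1≤-suc (suc k) r)) ⟩
  g (P + r) + g r + pbarNo1≤ P r ∎
  where
  open ≡-Reasoning
  P = suc (suc k)
  g = pbarNo1≤ (suc k)
  first : #layer (suc k) (P + r) 0 ≡ g r + g r
  first = trans (#layer-fits k (P + r) 0 (subst (_≤ P + r) (sym (*-identityʳ P)) (m≤m+n P r)))
                (cong (λ x → g x + g x) (trans (cong (P + r ∸_) (*-identityʳ P)) (m+n∸m≡n P r)))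
  beyond : ∀ i → r ≤ i → #layer (suc k) r i ≡ 0
  beyond i r≤i = #layer-overflow (suc k) r i (<⇒≱ (<-≤-trans (s≤s r≤i) (m≤n*m (suc i) P)))

pbarNo1≤-stable : ∀ j {k n} → n ≤ k → pbarNo1≤ (j + k) n ≡ pbarNo1≤ k n
pbarNo1≤-stable zero n≤k = refl
pbarNo1≤-stable (suc j) {k} {n} n≤k =
  trans (pbarNo1≤-below (j + k) n (s≤s (≤-trans n≤k (m≤n+m k j)))) (pbarNo1≤-stable j n≤k)

pbarNo1≤[k,0]≡1 : ∀ k → pbarNo1≤ k 0 ≡ 1
pbarNo1≤[k,0]≡1 zero = refl
pbarNo1≤[k,0]≡1 (suc k) = trans (pbarNo1≤-below k 0 z<s) (pbarNo1≤[k,0]≡1 k)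

pbarNo1≤[1+k,1]≡1 : ∀ k → pbarNo1≤ (suc k) 1 ≡ 1
pbarNo1≤[1+k,1]≡1 zero = refl
pbarNo1≤[1+k,1]≡1 (suc k) =
  trans (pbarNo1≤-below (suc k) 1 (s≤s (s≤s z≤n))) (pbarNo1≤[1+k,1]≡1 k)

-- A single 1 leaves n + 1 to be split into parts ≤ 0, which is impossible;
-- a repeated 1 has a non-overlined occurrence.
#layer-plain1 : ∀ n i → #layer 0 (suc (suc n)) i ≡ 0
#layer-plain1 n zero with 1 * 1 ≤? suc (suc n)
... | no _ = refl
... | yes _ = refl
#layer-plain1 n (suc i) with 1 * suc (suc i) ≤? suc (suc n)
... | no _ = refl
... | yes _ = trans (#noPlain1-++ (map (block false ∷_) L) (map (block true ∷_) L))
                    (cong₂ _+_ (#noPlain1-map-plain1 i false L) (#noPlain1-map-plain1 i true L))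
  where
  L = ovp 0 (suc (suc n) ∸ 1 * suc (suc i))
  block : Bool.Bool → Block
  block o = (1 , suc (suc i) , o)

pbarNo1≤[1,2+n]≡0 : ∀ n → pbarNo1≤ 1 (suc (suc n)) ≡ 0
pbarNo1≤[1,2+n]≡0 n = trans (pbarNo1≤-suc 0 (suc (suc n)))
  (sum-applyUpTo-truncate (#layer 0 (suc (suc n))) (z≤n {suc (suc n)}) (λ i _ → #layer-plain1 n i))

pbarNo1≤[2,2+n]≡2 : ∀ n → pbarNo1≤ 2 (suc (suc n)) ≡ 2
pbarNo1≤[2,2+n]≡2 n = trans (pbarNo1≤-above 0 n) (lower n)
  where
  lower : ∀ n → pbarNo1≤ 1 (suc (suc n)) + pbarNo1≤ 1 n + pbarNo1≤ 2 n ≡ 2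
  lower zero = refl
  lower (suc zero) = refl
  lower (suc (suc n))
    rewrite pbarNo1≤[1,2+n]≡0 (suc (suc n)) | pbarNo1≤[1,2+n]≡0 n | pbarNo1≤[2,2+n]≡2 n = refl

AtMostDoubles : ℕ → (ℕ → ℕ) → ℕ → Set
AtMostDoubles s f n = s + f (suc n) ≤ 2 * f n

slack-+ : ∀ s t x x′ {y y′} → s + y ≤ 2 * x → t + y′ ≤ 2 * x′ →
          (s + t) + (y + y′) ≤ 2 * (x + x′)
slack-+ s t x x′ {y} {y′} p q =
  subst₂ _≤_ (interchange s y t y′) (sym (*-distribˡ-+ 2 x x′)) (+-mono-≤ p q)

atMostDoubles-0 : ∀ k → AtMostDoubles 1 (pbarNo1≤ (suc k)) 0
atMostDoubles-0 k rewrite pbarNo1≤[1+k,1]≡1 k | pbarNo1≤[k,0]≡1 (suc k) = ≤-refl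

record GrowthBounds (K : ℕ) : Set where
  field
    doubles    : ∀ n → AtMostDoubles 0 (pbarNo1≤ K) n
    doubles-≥3 : ∀ n → 3 ≤ n → AtMostDoubles 2 (pbarNo1≤ K) n
    pivot      : AtMostDoubles 2 (pbarNo1≤ K) K
    pivot-≥3   : 3 ≤ K → AtMostDoubles 4 (pbarNo1≤ K) K

growthBounds-2 : GrowthBounds 2
growthBounds-2 = record
  { doubles = doubles
  ; doubles-≥3 = doubles-≥3
  ; pivot = ≤-refl
  ; pivot-≥3 = λ { (s≤s (s≤s ())) }
  }
  where
  doubles : ∀ n → AtMostDoubles 0 (pbarNo1≤ 2) n
  doubles zero = s≤s z≤n
  doubles (suc zero) = ≤-refl
  doubles (suc (suc n)) rewrite pbarNo1≤[2,2+n]≡2 (suc n) | pbarNo1≤[2,2+n]≡2 n = s≤s (s≤s z≤n)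
  doubles-≥3 : ∀ n → 3 ≤ n → AtMostDoubles 2 (pbarNo1≤ 2) n
  doubles-≥3 (suc zero) (s≤s ())
  doubles-≥3 (suc (suc n)) _ rewrite pbarNo1≤[2,2+n]≡2 (suc n) | pbarNo1≤[2,2+n]≡2 n = ≤-refl

data Position (K : ℕ) : ℕ → Set where
  below : ∀ {n} → n < K → Position K n
  at    : Position K K
  above : ∀ r → Position K (r + suc K)

position : ∀ K n → Position K n
position K n with <-cmp n K
... | tri< n<K _ _ = below n<K
... | tri≈ _ refl _ = at
... | tri> _ _ K<n = subst (Position K) (m∸n+n≡m K<n) (above (n ∸ suc K))

module NewPart (k : ℕ) (bounds : GrowthBounds (suc (suc k))) where
  open GrowthBounds bounds

  K = suc (suc k)
  P = suc K
  g = pbarNo1≤ K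
  H = pbarNo1≤ P

  3≤P : 3 ≤ P
  3≤P = s≤s (s≤s (s≤s z≤n))

  H-below : ∀ n → n < P → H n ≡ g n
  H-below = pbarNo1≤-below K

  H-above : ∀ r → H (r + P) ≡ g (r + P) + g r + H r
  H-above r = subst (λ n → H n ≡ g n + g r + H r) (+-comm P r) (pbarNo1≤-above (suc k) r)

  H-at : H P ≡ 2 + g P
  H-at = begin
    H P              ≡⟨ H-above 0 ⟩
    g P + g 0 + H 0  ≡⟨ cong₂ (λ x y → g P + x + y) (pbarNo1≤[k,0]≡1 K) (pbarNo1≤[k,0]≡1 P) ⟩
    g P + 1 + 1      ≡⟨ +-assoc (g P) 1 1 ⟩
    g P + 2          ≡⟨ +-comm (g P) 2 ⟩
    2 + g P          ∎
    where open ≡-Reasoning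

  atMostDoubles-above : ∀ {s t u r} → AtMostDoubles s g (r + P) → AtMostDoubles t g r →
                        AtMostDoubles u H r → AtMostDoubles (s + t + u) H (r + P)
  atMostDoubles-above {s} {t} {u} {r} p q w =
    subst₂ (λ a b → s + t + u + a ≤ 2 * b) (sym (H-above (suc r))) (sym (H-above r)) summed
    where
    summed : s + t + u + (g (suc r + P) + g (suc r) + H (suc r)) ≤ 2 * (g (r + P) + g r + H r)
    summed = slack-+ (s + t) u (g (r + P) + g r) (H r) (slack-+ s t (g (r + P)) (g r) p q) w

  doubles′ : ∀ n → AtMostDoubles 0 H n
  doubles′ = <-rec _ step
    where
    step : ∀ n → (∀ {m} → m < n → AtMostDoubles 0 H m) → AtMostDoubles 0 H n
    step n rec with position K n
    ... | below n<K rewrite H-below (suc n) (s≤s n<K) | H-below n (m<n⇒m<1+n n<K) = doubles n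
    ... | at rewrite H-at | H-below K ≤-refl = pivot
    ... | above r = atMostDoubles-above (doubles (r + P)) (doubles r) (rec (m<m+n r z<s))

  doubles-≥3′ : ∀ n → 3 ≤ n → AtMostDoubles 2 H n
  doubles-≥3′ n 3≤n with position K n
  ... | below n<K rewrite H-below (suc n) (s≤s n<K) | H-below n (m<n⇒m<1+n n<K) = doubles-≥3 n 3≤n
  ... | at rewrite H-at | H-below K ≤-refl = pivot-≥3 3≤n
  ... | above r =
    atMostDoubles-above (doubles-≥3 (r + P) (m≤n⇒m≤o+n r 3≤P)) (doubles r) (doubles′ r)

  growthBounds-suc : GrowthBounds P
  growthBounds-suc = record
    { doubles = doubles′
    ; doubles-≥3 = doubles-≥3′
    ; pivot = atMostDoubles-above (doubles P) (atMostDoubles-0 (suc k)) (atMostDoubles-0 K)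
    ; pivot-≥3 = λ _ →
        atMostDoubles-above (doubles-≥3 P 3≤P) (atMostDoubles-0 (suc k)) (atMostDoubles-0 K)
    }

growthBounds : ∀ k → GrowthBounds (2 + k)
growthBounds zero = growthBounds-2
growthBounds (suc k) = NewPart.growthBounds-suc k (growthBounds k)

lemma2p3 : (a : ℕ) → 2 ≤ a → pbarNo1 a * pbar 2 > pbarNo1 (a + 2)
lemma2p3 a 2≤a = begin-strict
  pbarNo1 (a + 2)          ≡⟨ cong (λ n → pbarNo1≤ n n) (+-comm a 2) ⟩
  pbarNo1≤ K (2 + a)       <⟨ m<n+m _ z<s ⟩
  2 + pbarNo1≤ K (2 + a)   ≤⟨ doubles-≥3 (suc a) (s≤s 2≤a) ⟩
  2 * pbarNo1≤ K (suc a)   ≤⟨ *-monoʳ-≤ 2 (doubles a) ⟩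
  2 * (2 * pbarNo1≤ K a)   ≡⟨ cong (λ x → 2 * (2 * x)) (pbarNo1≤-stable 2 (≤-refl {a})) ⟩
  2 * (2 * pbarNo1 a)      ≡⟨ sym (*-assoc 2 2 (pbarNo1 a)) ⟩
  4 * pbarNo1 a            ≡⟨ *-comm 4 (pbarNo1 a) ⟩
  pbarNo1 a * pbar 2       ∎
  where
  open ≤-Reasoning
  open GrowthBounds (growthBounds a)
  K = 2 + a
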